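{- Let $G=(V,E)$ be a finite loopless multigraph and let $(L,C)$ be a derangement assignment on $G$. Suppose there exists a biorientation $D$ of $G$ such that (i) the biorientation of $G_S$ induced by $D$ is kernel-perfect, (ii) $E_T(G)\subseteq E_{D2}(G)$, and (iii) $|L(v)|\geq d^+_D(v)+1$ for each $v\in V$. Then $G$ is $(L,C)$-colorable.
   Context: Graphs are finite loopless multigraphs; digraphs are finite loopless multidigraphs. A biorientation of $G$ is a digraph $D$ on $V(G)$ in which each edge $e=\{u,v\}$ of $G$ is replaced by the arc $(u,v)$, the arc $(v,u)$, or both (and there are no other arcs). $E_{D2}(G)$ is the set of edges of $G$ that are oriented in both directions in $D$. $d^+_D(v)$ is the out-degree of $v$ in $D$ (counting arcs with multiplicity). For $H$ a spanning subgraph of $G$, the biorientation of $H$ induced by $D$ is the subdigraph of $D$ consisting of the arcs coming from edges of $H$. A kernel of a digraph is an independent set $U$ of vertices such that every vertex $v\notin U$ has an arc $(v,u)$ to some $u\in U$; a digraph is kernel-perfect if every induced subdigraph has a kernel. A correspondence assignment $(L,C)$ for $G$ consists of lists $L(v)$ for $v\in V$ and, for each edge $e=\{u,v\}$, a partial matching $C_e$ between $\{u\}\times L(u)$ and $\{v\}\times L(v)$. An $(L,C)$-coloring is a function $\varphi$ with $\varphi(v)\in L(v)$ for all $v$ such that for every edge $e=\{u,v\}$, $(u,\varphi(u))$ and $(v,\varphi(v))$ are not matched in $C_e$; $G$ is $(L,C)$-colorable if one exists. An edge $e=\{u,v\}$ is straight if $\{(u,c_1),(v,c_2)\}\in C_e$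 implies $c_1=c_2$, and twisted otherwise. $E_S(G)$, $E_T(G)$ are the sets of straight and twisted edges, $G_S=(V,E_S(G))$, $G_T=(V,E_T(G))$. $C_e$ (for $e=\{v,w\}$) is a partial derangement if $\{(v,c),(w,c)\}\notin C_e$ for all $c\in L(v)\cap L(w)$. $(L,C)$ is a derangement assignment if $C_e$ is a partial derangement for every twisted edge $e$. -}

module Defs where

open import Data.Nat using (ℕ; zero; suc; _+_; _≤_)
open import Data.Fin using (Fin)
open import Data.Fin.Properties using () renaming (_≟_ to _≟ᶠ_)
open import Data.Fin.Subset using (Subset; _∈_; _∉_; _⊆_)
open import Data.List using (List; length; map; allFin)
open import Data.Nat.ListAction using (sum)
open import Data.List.Membership.Propositional using () renaming (_∈_ to _∈ˡ_; _∉_ to _∉ˡ_)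
open import Data.List.Relation.Unary.Unique.Propositional using (Unique)
open import Data.Product using (Σ; ∃; ∃-syntax; _×_; _,_; proj₁; proj₂)
open import Relation.Binary.PropositionalEquality using (_≡_; _≢_)
open import Relation.Nullary using (¬_; yes; no)

-- Each edge e has a (fixed, arbitrary) listing of its two distinct ends
-- (end₁ e , end₂ e); parallel edges are allowed (distinct e with same ends).
record Multigraph : Set where
  field
    n    : ℕ
    m    : ℕ
    end₁ : Fin m → Fin n
    end₂ : Fin m → Fin n
    loopless : (e : Fin m) → end₁ e ≢ end₂ e
open Multigraph public

-- Colours are natural numbers; L v is a duplicate-free list (a finite set).
-- C e is a finite list of pairs (c₁ , c₂), meaning that (end₁ e , c₁) is
-- matched with (end₂ e , c₂) in C_e.
record CorrAssignment (G : Multigraph) : Set where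
  field
    L : Fin (n G) → List ℕ
    L-unique : (v : Fin (n G)) → Unique (L v)
    C : Fin (m G) → List (ℕ × ℕ)
    C-unique : (e : Fin (m G)) → Unique (C e)
    C-dom : (e : Fin (m G)) (c₁ c₂ : ℕ) → (c₁ , c₂) ∈ˡ C e → c₁ ∈ˡ L (end₁ G e)
    C-cod : (e : Fin (m G)) (c₁ c₂ : ℕ) → (c₁ , c₂) ∈ˡ C e → c₂ ∈ˡ L (end₂ G e)
    C-matching₁ : (e : Fin (m G)) (c₁ c₂ c₂' : ℕ) →
      (c₁ , c₂) ∈ˡ C e → (c₁ , c₂') ∈ˡ C e → c₂ ≡ c₂'
    C-matching₂ : (e : Fin (m G)) (c₁ c₁' c₂ : ℕ) →
      (c₁ , c₂) ∈ˡ C e → (c₁' , c₂) ∈ˡ C e → c₁ ≡ c₁'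
open CorrAssignment public

module _ {G : Multigraph} (LC : CorrAssignment G) where

  Straight : Fin (m G) → Set
  Straight e = (c₁ c₂ : ℕ) → (c₁ , c₂) ∈ˡ C LC e → c₁ ≡ c₂

  Twisted : Fin (m G) → Set
  Twisted e = ¬ Straight e

  PartialDerangement : Fin (m G) → Set
  PartialDerangement e = (c : ℕ) → c ∈ˡ L LC (end₁ G e) → c ∈ˡ L LC (end₂ G e) →
    (c , c) ∉ˡ C LC e

  IsDerangementAssignment : Set
  IsDerangementAssignment = (e : Fin (m G)) → Twisted e → PartialDerangement e

  IsColoring : (Fin (n G) → ℕ) → Set
  IsColoring φ = ((v : Fin (n G)) → φ v ∈ˡ L LC v) ×
    ((e : Fin (m G)) → (φ (end₁ G e) , φ (end₂ G e)) ∉ˡ C LC e)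

  Colorable : Set
  Colorable = Σ (Fin (n G) → ℕ) IsColoring

data Ori : Set where
  fwd bwd both : Ori

Biorientation : Multigraph → Set
Biorientation G = Fin (m G) → Ori

module _ {G : Multigraph} (D : Biorientation G) where

  ArcOf : Fin (m G) → Fin (n G) → Fin (n G) → Set
  ArcOf e v w with D e
  ... | fwd  = (v ≡ end₁ G e) × (w ≡ end₂ G e)
  ... | bwd  = (v ≡ end₂ G e) × (w ≡ end₁ G e)
  ... | both = ((v ≡ end₁ G e) × (w ≡ end₂ G e)) Data.Sum.⊎ ((v ≡ end₂ G e) × (w ≡ end₁ G e))
    where import Data.Sum

  outContrib : Fin (m G) → Fin (n G) → ℕ
  outContrib e v with D e | v ≟ᶠ end₁ G e | v ≟ᶠ end₂ G e
  ... | fwd  | yes _ | _     = 1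
  ... | fwd  | no _  | _     = 0
  ... | bwd  | _     | yes _ = 1
  ... | bwd  | _     | no _  = 0
  ... | both | yes _ | _     = 1
  ... | both | no _  | yes _ = 1
  ... | both | no _  | no _  = 0

  outdeg : Fin (n G) → ℕ
  outdeg v = sum (map (λ e → outContrib e v) (allFin (m G)))

  InBoth : Fin (m G) → Set
  InBoth e = D e ≡ both

module _ {k : ℕ} (Arc : Fin k → Fin k → Set) where

  IsKernelIn : Subset k → Subset k → Set
  IsKernelIn S U = (U ⊆ S) ×
    (((u w : Fin k) → u ∈ U → w ∈ U → ¬ Arc u w) ×
     ((v : Fin k) → v ∈ S → v ∉ U → Σ (Fin k) (λ u → u ∈ U × Arc v u)))

  KernelPerfect : Set
  KernelPerfect = (S : Subset k) → Σ (Subset k) (IsKernelIn S)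

module _ {G : Multigraph} (LC : CorrAssignment G) (D : Biorientation G) where

  StraightArc : Fin (n G) → Fin (n G) → Set
  StraightArc v w = Σ (Fin (m G)) (λ e → Straight LC e × ArcOf {G} D e v w)

-- The kernel method of Bondy, Boppana and Siegel.  Colour greedily in rounds, keeping a
-- proper colouring of V ∖ R and, for every uncoloured v ∈ R, a reserve list of colours
-- compatible with its coloured neighbours that is longer than the out-degree of v into R.
-- In a round pick a colour c and a kernel U of the straight digraph induced on the vertices
-- of R whose reserve contains c, and give c to all of U: a straight edge inside U would be
-- an arc inside the kernel, and on a twisted one (c , c) is not matched.  Every v ∈ R ∖ U
-- then drops c and each colour matched to c along an edge into U.  Along a twisted edge,
-- bioriented by hypothesis, at most one colour goes and v loses an out-arc into U; along a
-- straight edge only c itself can go, and if c was in the reserve of v then the absorbing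
-- straight arc from v into U pays for it.  So the invariant survives while R shrinks.

module Submission where

open import Defs
open import Data.Nat using (ℕ; suc; _≤_)
open import Data.Fin using (Fin)
open import Data.List using (length)

open import Level using (Level)
open import Data.Nat using (_+_; _<_; z≤n; s≤s)
open import Data.Nat.Properties
  using (+-identityʳ; +-assoc; +-comm; +-mono-≤; +-monoˡ-≤; +-monoʳ-≤; +-mono-<-≤; +-suc;
         +-cancelʳ-≤; m≤m+n; ≤-refl; ≤-trans; ≤-reflexive; module ≤-Reasoning;
         +-commutativeSemigroup)
  renaming (_≟_ to _≟ℕ_)
open import Data.Nat.Induction using (<-wellFounded)
open import Data.Nat.ListAction using (sum)
open import Data.Bool using (true; false; if_then_else_)
open import Data.Empty using (⊥-elim)
open import Data.Product using (Σ; ∃; _×_; _,_; proj₁; proj₂)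
open import Data.Product.Properties using (≡-dec)
open import Data.Sum using (_⊎_; inj₁; inj₂)
open import Data.List using (List; []; _∷_; map; foldr; filter; allFin)
open import Data.List.Properties using (map-cong)
open import Data.List.Membership.Propositional using () renaming (_∈_ to _∈ˡ_)
open import Data.List.Membership.Propositional.Properties using (∈-filter⁻; ∈-allFin)
import Data.List.Membership.DecPropositional as DecMembership
open import Data.List.Relation.Binary.Subset.Propositional using () renaming (_⊆_ to _⊆ˡ_)
open import Data.List.Relation.Unary.Any using (here; there)
open import Data.List.Relation.Unary.All as All using (All; []; _∷_)
open import Data.List.Relation.Unary.AllPairs using (_∷_)
open import Data.List.Relation.Unary.Unique.Propositional using (Unique)
open import Data.List.Relation.Unary.Unique.Propositional.Properties using (filter⁺)
open import Data.Fin.Properties using (any?) renaming (_≟_ to _≟ᶠ_)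
open import Data.Fin.Subset
  using (Subset; _∈_; _∉_; _⊆_; _─_; _∩_; ⊤; ∣_∣; Nonempty; Empty)
open import Data.Fin.Subset.Properties
  using (_∈?_; ∈⊤; nonempty?; x∈p∧x∉q⇒x∈p─q; p─q⊆p; p∩q≢∅⇒∣p─q∣<∣p∣; x∈p∩q⁺)
open import Data.Vec using (_∷_; tabulate; here; there)
open import Data.Vec.Properties using (lookup∘tabulate; lookup⇒[]=; []=⇒lookup)
open import Induction.WellFounded using (Acc; acc)
open import Relation.Binary.PropositionalEquality using (_≡_; _≢_; refl; sym; trans; cong)
open import Relation.Nullary using (¬_; Dec; yes; no; does)
open import Relation.Nullary.Decidable using (dec-true; _×-dec_; _⊎-dec_)
open import Relation.Unary using (Pred; Decidable)
open import Relation.Unary.Properties using (∁?)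
open import Algebra.Properties.CommutativeSemigroup +-commutativeSemigroup using (interchange)

private
  variable
    a p : Level
    A E : Set a

length-≤-of-subsingleton : ∀ {xs : List A} {k} → Unique xs → (∀ {x y} → x ∈ˡ xs → y ∈ˡ xs → x ≡ y) →
  (∀ {x} → x ∈ˡ xs → 1 ≤ k) → length xs ≤ k
length-≤-of-subsingleton {xs = []} _ _ _ = z≤n
length-≤-of-subsingleton {xs = x ∷ []} _ _ nonempty = nonempty (here refl)
length-≤-of-subsingleton {xs = x ∷ y ∷ _} ((x≢y ∷ _) ∷ _) equal _ =
  ⊥-elim (x≢y (equal (here refl) (there (here refl))))

module _ {P : Pred A p} (P? : Decidable P) where

  length-filter-∁ : ∀ xs → length (filter P? xs) + length (filter (∁? P?) xs) ≡ length xs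
  length-filter-∁ [] = refl
  length-filter-∁ (x ∷ xs) with does (P? x)
  ... | true  = cong suc (length-filter-∁ xs)
  ... | false = trans (+-suc _ _) (cong suc (length-filter-∁ xs))

  length-≤-filter-∁+ : ∀ {xs k} → Unique xs →
    (∀ {x y} → x ∈ˡ xs → y ∈ˡ xs → P x → P y → x ≡ y) →
    (∀ {x} → x ∈ˡ xs → P x → 1 ≤ k) →
    length xs ≤ length (filter (∁? P?) xs) + k
  length-≤-filter-∁+ {xs} {k} uniq functional costly = begin
    length xs                                          ≡⟨ sym (length-filter-∁ xs) ⟩
    length (filter P? xs) + length (filter (∁? P?) xs) ≤⟨ +-monoˡ-≤ _ filtered≤k ⟩
    k + length (filter (∁? P?) xs)                     ≡⟨ +-comm k _ ⟩
    length (filter (∁? P?) xs) + k                     ∎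
    where
    open ≤-Reasoning
    in-filter : ∀ {x} → x ∈ˡ filter P? xs → x ∈ˡ xs × P x
    in-filter = ∈-filter⁻ P? {xs = xs}
    filtered≤k : length (filter P? xs) ≤ k
    filtered≤k = length-≤-of-subsingleton (filter⁺ P? uniq)
      (λ x∈ y∈ → functional (proj₁ (in-filter x∈)) (proj₁ (in-filter y∈))
                            (proj₂ (in-filter x∈)) (proj₂ (in-filter y∈)))
      (λ x∈ → costly (proj₁ (in-filter x∈)) (proj₂ (in-filter x∈)))

module _ {P : E → Pred A p} (P? : ∀ e → Decidable (P e)) where

  sieve : List E → List A → List A
  sieve es xs = foldr (λ e → filter (P? e)) xs es

  ∈-sieve⁻ : ∀ es {xs x} → x ∈ˡ sieve es xs → x ∈ˡ xs × All (λ e → P e x) es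
  ∈-sieve⁻ [] x∈ = x∈ , []
  ∈-sieve⁻ (e ∷ es) x∈ =
    let x∈′ , px = ∈-filter⁻ (P? e) x∈
        x∈xs , pxs = ∈-sieve⁻ es x∈′
    in x∈xs , px ∷ pxs

  sieve-unique : ∀ es {xs} → Unique xs → Unique (sieve es xs)
  sieve-unique [] u = u
  sieve-unique (e ∷ es) u = filter⁺ (P? e) (sieve-unique es u)

  length-sieve : ∀ {xs} (k : E → ℕ) →
    (∀ e {ys} → ys ⊆ˡ xs → Unique ys → length ys ≤ length (filter (P? e) ys) + k e) →
    Unique xs → ∀ es → length xs ≤ length (sieve es xs) + sum (map k es)
  length-sieve k loss u [] = m≤m+n _ 0
  length-sieve {xs} k loss u (e ∷ es) = begin
    length xs                                                  ≤⟨ length-sieve k loss u es ⟩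
    length (sieve es xs) + sum (map k es)                      ≤⟨ +-monoˡ-≤ _ step ⟩
    length kept + k e + sum (map k es)                         ≡⟨ +-assoc (length kept) (k e) _ ⟩
    length (sieve (e ∷ es) xs) + sum (map k (e ∷ es))          ∎
    where
    open ≤-Reasoning
    kept : List A
    kept = filter (P? e) (sieve es xs)
    step : length (sieve es xs) ≤ length kept + k e
    step = loss e (λ x∈ → proj₁ (∈-sieve⁻ es x∈)) (sieve-unique es u)

module _ (f g : A → ℕ) where

  sum-map-+ : ∀ xs → sum (map (λ x → f x + g x) xs) ≡ sum (map f xs) + sum (map g xs)
  sum-map-+ [] = refl
  sum-map-+ (x ∷ xs) = trans (cong (f x + g x +_) (sum-map-+ xs)) (interchange (f x) (g x) _ _)

  sum-map-mono : (∀ x → f x ≤ g x) → ∀ xs → sum (map f xs) ≤ sum (map g xs)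
  sum-map-mono f≤g [] = z≤n
  sum-map-mono f≤g (x ∷ xs) = +-mono-≤ (f≤g x) (sum-map-mono f≤g xs)

  sum-map-< : (∀ x → f x ≤ g x) → ∀ {x₀ xs} → x₀ ∈ˡ xs → f x₀ < g x₀ →
    sum (map f xs) < sum (map g xs)
  sum-map-< f≤g {xs = x ∷ xs} (here refl) lt = +-mono-<-≤ lt (sum-map-mono f≤g xs)
  sum-map-< f≤g {xs = x ∷ xs} (there x₀∈) lt =
    ≤-trans (≤-reflexive (sym (+-suc (f x) _))) (+-mono-≤ (f≤g x) (sum-map-< f≤g x₀∈ lt))

∃-∈-of-suc≤length : ∀ {k} {xs : List A} → suc k ≤ length xs → ∃ λ x → x ∈ˡ xs
∃-∈-of-suc≤length {xs = x ∷ _} _ = x , here refl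

x∈p─q⇒x∉q : ∀ {k} {x : Fin k} {p q : Subset k} → x ∈ p ─ q → x ∉ q
x∈p─q⇒x∉q {p = _ ∷ _} {_ ∷ _} () here
x∈p─q⇒x∉q {p = _ ∷ _} {_ ∷ _} (there x∈) (there x∈q) = x∈p─q⇒x∉q x∈ x∈q

module _ {k : ℕ} where

  ⟦_⟧ : {P : Pred (Fin k) p} → Decidable P → Subset k
  ⟦ P? ⟧ = tabulate (λ i → does (P? i))

  ∈⟦⟧⁺ : {P : Pred (Fin k) p} (P? : Decidable P) {i : Fin k} → P i → i ∈ ⟦ P? ⟧
  ∈⟦⟧⁺ P? {i} pi = lookup⇒[]= i _ (trans (lookup∘tabulate _ i) (dec-true (P? i) pi))

  ∈⟦⟧⁻ : {P : Pred (Fin k) p} (P? : Decidable P) {i : Fin k} → i ∈ ⟦ P? ⟧ → P i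
  ∈⟦⟧⁻ P? {i} i∈ with P? i | trans (sym (lookup∘tabulate (λ j → does (P? j)) i)) ([]=⇒lookup i∈)
  ... | yes pi | _  = pi
  ... | no _   | ()

  when∈ : Subset k → Fin k → ℕ → ℕ
  when∈ R w x = if does (w ∈? R) then x else 0

  when∈≤ : ∀ R w x → when∈ R w x ≤ x
  when∈≤ R w x with does (w ∈? R)
  ... | true  = ≤-refl
  ... | false = z≤n

  when∈-─ : ∀ {R U} → U ⊆ R → ∀ w x → when∈ R w x ≡ when∈ (R ─ U) w x + when∈ U w x
  when∈-─ {R} {U} U⊆R w x with w ∈? U | w ∈? R | w ∈? R ─ U
  ... | yes w∈U | yes _   | yes w∈R─U = ⊥-elim (x∈p─q⇒x∉q w∈R─U w∈U)
  ... | yes _   | yes _   | no _      = refl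
  ... | yes w∈U | no w∉R  | _         = ⊥-elim (w∉R (U⊆R w∈U))
  ... | no _    | yes _   | yes _     = sym (+-identityʳ x)
  ... | no w∉U  | yes w∈R | no w∉R─U  = ⊥-elim (w∉R─U (x∈p∧x∉q⇒x∈p─q w∈R w∉U))
  ... | no _    | no w∉R  | yes w∈R─U = ⊥-elim (w∉R (p─q⊆p R U w∈R─U))
  ... | no _    | no _    | no _      = refl

module Incidence (G : Multigraph) where

  Vertex Edge : Set
  Vertex = Fin (n G)
  Edge = Fin (m G)

  Joins : Edge → Vertex → Vertex → Set
  Joins e v w = (v ≡ end₁ G e × w ≡ end₂ G e) ⊎ (v ≡ end₂ G e × w ≡ end₁ G e)

  Joins-ends : ∀ {q} (Q : Pred Vertex q) {e v w} → Joins e v w → Q v → Q w →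
    Q (end₁ G e) × Q (end₂ G e)
  Joins-ends Q (inj₁ (refl , refl)) qv qw = qv , qw
  Joins-ends Q (inj₂ (refl , refl)) qv qw = qw , qv

  other : Edge → Vertex → Vertex
  other e v with v ≟ᶠ end₁ G e
  ... | yes _ = end₂ G e
  ... | no _  = end₁ G e

  Joins⇒other : ∀ {e v w} → Joins e v w → other e v ≡ w
  Joins⇒other {e} (inj₁ (refl , refl)) with end₁ G e ≟ᶠ end₁ G e
  ... | yes _      = refl
  ... | no e₁≢e₁   = ⊥-elim (e₁≢e₁ refl)
  Joins⇒other {e} (inj₂ (refl , refl)) with end₂ G e ≟ᶠ end₁ G e
  ... | yes e₂≡e₁  = ⊥-elim (loopless G e (sym e₂≡e₁))
  ... | no _       = refl

module Arcs {G : Multigraph} (D : Biorientation G) where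
  open Incidence G

  ArcOf⇒Joins : ∀ {e v w} → ArcOf {G} D e v w → Joins e v w
  ArcOf⇒Joins {e} arc with D e
  ... | fwd  = inj₁ arc
  ... | bwd  = inj₂ arc
  ... | both = arc

  Joins⇒ArcOf⊎ : ∀ {e v w} → Joins e v w → ArcOf {G} D e v w ⊎ ArcOf {G} D e w v
  Joins⇒ArcOf⊎ {e} j with D e | j
  ... | fwd  | inj₁ vw       = inj₁ vw
  ... | fwd  | inj₂ (p , q)  = inj₂ (q , p)
  ... | bwd  | inj₁ (p , q)  = inj₂ (q , p)
  ... | bwd  | inj₂ vw       = inj₁ vw
  ... | both | _             = inj₁ j

  both⇒ArcOf : ∀ {e v w} → InBoth {G} D e → Joins e v w → ArcOf {G} D e v w
  both⇒ArcOf {e} bi j with D e | bi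
  ... | both | refl = j

  ArcOf⇒outContrib≡1 : ∀ {e v w} → ArcOf {G} D e v w → outContrib {G} D e v ≡ 1
  ArcOf⇒outContrib≡1 {e} {v} arc with D e | v ≟ᶠ end₁ G e | v ≟ᶠ end₂ G e
  ... | fwd  | yes _ | _     = refl
  ... | fwd  | no ≢₁ | _     = ⊥-elim (≢₁ (proj₁ arc))
  ... | bwd  | _     | yes _ = refl
  ... | bwd  | _     | no ≢₂ = ⊥-elim (≢₂ (proj₁ arc))
  ... | both | yes _ | _     = refl
  ... | both | no _  | yes _ = refl
  ... | both | no ≢₁ | no ≢₂ with arc
  ...   | inj₁ (v≡ , _) = ⊥-elim (≢₁ v≡)
  ...   | inj₂ (v≡ , _) = ⊥-elim (≢₂ v≡)

  outContribInto : Subset (n G) → Edge → Vertex → ℕ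
  outContribInto R e v = when∈ R (other e v) (outContrib {G} D e v)

  outdegInto : Subset (n G) → Vertex → ℕ
  outdegInto R v = sum (map (λ e → outContribInto R e v) (allFin (m G)))

  ArcOf⇒outContribInto≡1 : ∀ {R e v w} → ArcOf {G} D e v w → w ∈ R → outContribInto R e v ≡ 1
  ArcOf⇒outContribInto≡1 {R} {w = w} arc w∈R
    rewrite Joins⇒other (ArcOf⇒Joins arc) | dec-true (w ∈? R) w∈R = ArcOf⇒outContrib≡1 arc

  outdegInto≤outdeg : ∀ R v → outdegInto R v ≤ outdeg {G} D v
  outdegInto≤outdeg R v = sum-map-mono _ _ (λ e → when∈≤ R (other e v) _) (allFin (m G))

  outdegInto-─ : ∀ {R U} → U ⊆ R → ∀ v → outdegInto R v ≡ outdegInto (R ─ U) v + outdegInto U v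
  outdegInto-─ {R} {U} U⊆R v = trans
    (cong sum (map-cong (λ e → when∈-─ U⊆R (other e v) _) (allFin (m G))))
    (sum-map-+ _ _ (allFin (m G)))

module Clashes {G : Multigraph} (LC : CorrAssignment G) where
  open Incidence G

  Clash : Edge → Vertex → ℕ → Vertex → ℕ → Set
  Clash e v x w y =
    (v ≡ end₁ G e × w ≡ end₂ G e × (x , y) ∈ˡ C LC e) ⊎
    (v ≡ end₂ G e × w ≡ end₁ G e × (y , x) ∈ˡ C LC e)

  Clash? : ∀ e v x w y → Dec (Clash e v x w y)
  Clash? e v x w y =
    (v ≟ᶠ end₁ G e ×-dec w ≟ᶠ end₂ G e ×-dec (x , y) ∈² C LC e) ⊎-dec
    (v ≟ᶠ end₂ G e ×-dec w ≟ᶠ end₁ G e ×-dec (y , x) ∈² C LC e)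
    where open DecMembership (≡-dec _≟ℕ_ _≟ℕ_) using () renaming (_∈?_ to _∈²_)

  Clash-sym : ∀ {e v x w y} → Clash e v x w y → Clash e w y v x
  Clash-sym (inj₁ (p , q , xy)) = inj₂ (q , p , xy)
  Clash-sym (inj₂ (p , q , yx)) = inj₁ (q , p , yx)

  Clash⇒Joins : ∀ {e v x w y} → Clash e v x w y → Joins e v w
  Clash⇒Joins (inj₁ (p , q , _)) = inj₁ (p , q)
  Clash⇒Joins (inj₂ (p , q , _)) = inj₂ (p , q)

  Clash-diagonal : ∀ {e v w x} → Clash e v x w x → (x , x) ∈ˡ C LC e
  Clash-diagonal (inj₁ (_ , _ , xx)) = xx
  Clash-diagonal (inj₂ (_ , _ , xx)) = xx

  Clash-functional : ∀ {e v x x′ w w′ y} → Clash e v x w y → Clash e v x′ w′ y → x ≡ x′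
  Clash-functional {e} (inj₁ (_ , _ , xy)) (inj₁ (_ , _ , x′y)) = C-matching₂ LC e _ _ _ xy x′y
  Clash-functional {e} (inj₂ (_ , _ , yx)) (inj₂ (_ , _ , yx′)) = C-matching₁ LC e _ _ _ yx yx′
  Clash-functional {e} (inj₁ (v≡ , _)) (inj₂ (v≡′ , _)) = ⊥-elim (loopless G e (trans (sym v≡) v≡′))
  Clash-functional {e} (inj₂ (v≡ , _)) (inj₁ (v≡′ , _)) = ⊥-elim (loopless G e (trans (sym v≡′) v≡))

  Clash⇒Twisted : ∀ {e v x w y} → Clash e v x w y → x ≢ y → Twisted LC e
  Clash⇒Twisted (inj₁ (_ , _ , xy)) x≢y straight = x≢y (straight _ _ xy)
  Clash⇒Twisted (inj₂ (_ , _ , yx)) x≢y straight = x≢y (sym (straight _ _ yx))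

module KernelColouring {G : Multigraph} (LC : CorrAssignment G)
  (derangement : IsDerangementAssignment LC) (D : Biorientation G)
  (kernel-perfect : KernelPerfect (StraightArc LC D))
  (twisted⇒both : (e : Fin (m G)) → Twisted LC e → InBoth {G} D e) where
  open Incidence G
  open Arcs {G} D
  open Clashes LC

  record Admissible (R : Subset (n G)) (φ : Vertex → ℕ) (A : Vertex → List ℕ) : Set where
    field
      coloured-∈L     : ∀ {v} → v ∉ R → φ v ∈ˡ L LC v
      coloured-proper : ∀ e {v w} → v ∉ R → w ∉ R → ¬ Clash e v (φ v) w (φ w)
      reserve-unique  : ∀ {v} → v ∈ R → Unique (A v)
      reserve-⊆L      : ∀ {v} → v ∈ R → A v ⊆ˡ L LC v
      reserve-safe    : ∀ {v x} → v ∈ R → x ∈ˡ A v → ∀ e {w} → w ∉ R → ¬ Clash e v x w (φ w)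
      reserve-large   : ∀ {v} → v ∈ R → suc (outdegInto R v) ≤ length (A v)

  admissible-⊤ : ((v : Vertex) → suc (outdeg {G} D v) ≤ length (L LC v)) →
    Admissible ⊤ (λ _ → 0) (L LC)
  admissible-⊤ large = record
    { coloured-∈L     = λ v∉⊤ → ⊥-elim (v∉⊤ ∈⊤)
    ; coloured-proper = λ e v∉⊤ _ → ⊥-elim (v∉⊤ ∈⊤)
    ; reserve-unique  = λ {v} _ → L-unique LC v
    ; reserve-⊆L      = λ _ x∈ → x∈
    ; reserve-safe    = λ _ _ e w∉⊤ → ⊥-elim (w∉⊤ ∈⊤)
    ; reserve-large   = λ {v} _ → ≤-trans (s≤s (outdegInto≤outdeg ⊤ v)) (large v)
    }

  admissible-∅⇒Colorable : ∀ {R φ A} → Admissible R φ A → Empty R → Colorable LC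
  admissible-∅⇒Colorable {R} {φ} adm R-empty =
    φ , (λ v → coloured-∈L (uncoloured v)) ,
        (λ e xy → coloured-proper e (uncoloured _) (uncoloured _) (inj₁ (refl , refl , xy)))
    where
    open Admissible adm
    uncoloured : ∀ v → v ∉ R
    uncoloured v v∈R = R-empty (v , v∈R)

  module Round {R φ A} (adm : Admissible R φ A) (c : ℕ) where
    open Admissible adm
    open DecMembership _≟ℕ_ using () renaming (_∈?_ to _∈ˡ?_)

    InS? : Decidable (λ v → v ∈ R × c ∈ˡ A v)
    InS? v = v ∈? R ×-dec c ∈ˡ? A v

    S : Subset (n G)
    S = ⟦ InS? ⟧

    U : Subset (n G)
    U = proj₁ (kernel-perfect S)

    U⊆S : U ⊆ S
    U⊆S = proj₁ (proj₂ (kernel-perfect S))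

    U-independent : ∀ u w → u ∈ U → w ∈ U → ¬ StraightArc LC D u w
    U-independent = proj₁ (proj₂ (proj₂ (kernel-perfect S)))

    U-absorbing : ∀ v → v ∈ S → v ∉ U → Σ Vertex (λ u → u ∈ U × StraightArc LC D v u)
    U-absorbing = proj₂ (proj₂ (proj₂ (kernel-perfect S)))

    U⊆R : U ⊆ R
    U⊆R u∈U = proj₁ (∈⟦⟧⁻ InS? (U⊆S u∈U))

    c∈A : ∀ {u} → u ∈ U → c ∈ˡ A u
    c∈A u∈U = proj₂ (∈⟦⟧⁻ InS? (U⊆S u∈U))

    c∈L : ∀ {u} → u ∈ U → c ∈ˡ L LC u
    c∈L u∈U = reserve-⊆L (U⊆R u∈U) (c∈A u∈U)

    R′ : Subset (n G)
    R′ = R ─ U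

    φ′ : Vertex → ℕ
    φ′ v = if does (v ∈? U) then c else φ v

    Blocked : Edge → Vertex → ℕ → Set
    Blocked e v x = Σ Vertex λ u → u ∈ U × Clash e v x u c

    Blocked? : ∀ e v → Decidable (Blocked e v)
    Blocked? e v x = any? (λ u → u ∈? U ×-dec Clash? e v x u c)

    A∖c : Vertex → List ℕ
    A∖c v = filter (∁? (_≟ℕ c)) (A v)

    A′ : Vertex → List ℕ
    A′ v = sieve (λ e → ∁? (Blocked? e v)) (allFin (m G)) (A∖c v)

    A∖c-≢c : ∀ {v x} → x ∈ˡ A∖c v → x ≢ c
    A∖c-≢c {v} x∈ = proj₂ (∈-filter⁻ (∁? (_≟ℕ c)) {xs = A v} x∈)

    A′⊆A : ∀ {v x} → x ∈ˡ A′ v → x ∈ˡ A v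
    A′⊆A {v} x∈ = proj₁ (∈-filter⁻ (∁? (_≟ℕ c)) {xs = A v} (proj₁ (∈-sieve⁻ _ (allFin (m G)) x∈)))

    A′-unblocked : ∀ {v x} → x ∈ˡ A′ v → ∀ e → ¬ Blocked e v x
    A′-unblocked x∈ e = All.lookup (proj₂ (∈-sieve⁻ _ (allFin (m G)) x∈)) (∈-allFin e)

    ∉R′⇒∉R : ∀ {v} → v ∉ R′ → v ∉ U → v ∉ R
    ∉R′⇒∉R v∉R′ v∉U v∈R = v∉R′ (x∈p∧x∉q⇒x∈p─q v∈R v∉U)

    U-clash-free : ∀ e {v w} → v ∈ U → w ∈ U → ¬ Clash e v c w c
    U-clash-free e v∈U w∈U clash =
      derangement e twisted c (proj₁ ends) (proj₂ ends) (Clash-diagonal clash)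
      where
      twisted : Twisted LC e
      twisted straight with Joins⇒ArcOf⊎ (Clash⇒Joins clash)
      ... | inj₁ arc = U-independent _ _ v∈U w∈U (e , straight , arc)
      ... | inj₂ arc = U-independent _ _ w∈U v∈U (e , straight , arc)
      ends : c ∈ˡ L LC (end₁ G e) × c ∈ˡ L LC (end₂ G e)
      ends = Joins-ends (λ u → c ∈ˡ L LC u) (Clash⇒Joins clash) (c∈L v∈U) (c∈L w∈U)

    blocked-functional : ∀ {e v x y} → Blocked e v x → Blocked e v y → x ≡ y
    blocked-functional (_ , _ , clash) (_ , _ , clash′) = Clash-functional clash clash′

    blocked⇒outContribInto≡1 : ∀ {e v x} → x ≢ c → Blocked e v x → outContribInto U e v ≡ 1
    blocked⇒outContribInto≡1 {e} x≢c (u , u∈U , clash) = ArcOf⇒outContribInto≡1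
      (both⇒ArcOf (twisted⇒both e (Clash⇒Twisted clash x≢c)) (Clash⇒Joins clash)) u∈U

    EdgeLoss : Vertex → Edge → ℕ → Set
    EdgeLoss v e k = ∀ {ys} → ys ⊆ˡ A∖c v → Unique ys →
      length ys ≤ length (filter (∁? (Blocked? e v)) ys) + k

    edge-loss : ∀ v e → EdgeLoss v e (outContribInto U e v)
    edge-loss v e ys⊆ uniq = length-≤-filter-∁+ (Blocked? e v) uniq
      (λ _ _ → blocked-functional)
      (λ y∈ blocked → ≤-reflexive (sym (blocked⇒outContribInto≡1 (A∖c-≢c (ys⊆ y∈)) blocked)))

    straight-edge-loss : ∀ v e → Straight LC e → EdgeLoss v e 0
    straight-edge-loss v e straight ys⊆ uniq = length-≤-filter-∁+ (Blocked? e v) uniq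
      (λ _ _ → blocked-functional)
      (λ y∈ (_ , _ , clash) → ⊥-elim (Clash⇒Twisted clash (A∖c-≢c (ys⊆ y∈)) straight))

    c-loss : ∀ {v} k → v ∈ R → (c ∈ˡ A v → 1 ≤ k) → length (A v) ≤ length (A∖c v) + k
    c-loss k v∈R costly = length-≤-filter-∁+ (_≟ℕ c) (reserve-unique v∈R)
      (λ _ _ x≡c y≡c → trans x≡c (sym y≡c)) (λ { x∈ refl → costly x∈ })

    reserve-loss-by : ∀ {v} (b : ℕ) (k : Edge → ℕ) → v ∈ R →
      length (A v) ≤ length (A∖c v) + b → (∀ e → EdgeLoss v e (k e)) →
      b + sum (map k (allFin (m G))) ≤ outdegInto U v →
      length (A v) ≤ length (A′ v) + outdegInto U v
    reserve-loss-by {v} b k v∈R c-loss loss budget = begin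
      length (A v)                                      ≤⟨ c-loss ⟩
      length (A∖c v) + b                                ≤⟨ +-monoˡ-≤ b sieved ⟩
      length (A′ v) + sum (map k (allFin (m G))) + b     ≡⟨ +-assoc (length (A′ v)) _ b ⟩
      length (A′ v) + (sum (map k (allFin (m G))) + b)   ≡⟨ cong (length (A′ v) +_) (+-comm _ b) ⟩
      length (A′ v) + (b + sum (map k (allFin (m G))))   ≤⟨ +-monoʳ-≤ (length (A′ v)) budget ⟩
      length (A′ v) + outdegInto U v                  ∎
      where
      open ≤-Reasoning
      sieved : length (A∖c v) ≤ length (A′ v) + sum (map k (allFin (m G)))
      sieved = length-sieve _ k (λ e → loss e)
        (filter⁺ (∁? (_≟ℕ c)) (reserve-unique v∈R)) (allFin (m G))

    -- Vertices of S ∖ U lose c but also an arc into U along their absorbing straight edge.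
    reserve-loss : ∀ {v} → v ∈ R → v ∉ U → length (A v) ≤ length (A′ v) + outdegInto U v
    reserve-loss {v} v∈R v∉U with c ∈ˡ? A v
    ... | no c∉A = reserve-loss-by 0 (λ e → outContribInto U e v) v∈R
      (c-loss 0 v∈R (λ c∈A → ⊥-elim (c∉A c∈A))) (edge-loss v) ≤-refl
    ... | yes c∈Av with U-absorbing v (∈⟦⟧⁺ InS? (v∈R , c∈Av)) v∉U
    ...   | u , u∈U , e₀ , straight , arc = reserve-loss-by 1 k v∈R
      (c-loss 1 v∈R (λ _ → ≤-refl)) loss (sum-map-< k _ k≤ (∈-allFin e₀) k<)
      where
      k : Edge → ℕ
      k e = if does (e ≟ᶠ e₀) then 0 else outContribInto U e v
      loss : ∀ e → EdgeLoss v e (k e)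
      loss e with e ≟ᶠ e₀
      ... | yes refl = straight-edge-loss v e₀ straight
      ... | no _     = edge-loss v e
      k≤ : ∀ e → k e ≤ outContribInto U e v
      k≤ e with e ≟ᶠ e₀
      ... | yes _ = z≤n
      ... | no _  = ≤-refl
      k< : k e₀ < outContribInto U e₀ v
      k< with e₀ ≟ᶠ e₀
      ... | yes _ rewrite ArcOf⇒outContribInto≡1 {U} arc u∈U = s≤s z≤n
      ... | no ≢ = ⊥-elim (≢ refl)

    reserve-large′ : ∀ {v} → v ∈ R′ → suc (outdegInto R′ v) ≤ length (A′ v)
    reserve-large′ {v} v∈R′ = +-cancelʳ-≤ (outdegInto U v) _ _ (begin
      suc (outdegInto R′ v) + outdegInto U v  ≡⟨ cong suc (sym (outdegInto-─ U⊆R v)) ⟩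
      suc (outdegInto R v)                     ≤⟨ reserve-large v∈R ⟩
      length (A v)                               ≤⟨ reserve-loss v∈R (x∈p─q⇒x∉q v∈R′) ⟩
      length (A′ v) + outdegInto U v           ∎)
      where
      open ≤-Reasoning
      v∈R = p─q⊆p R U v∈R′

    coloured-∈L′ : ∀ {v} → v ∉ R′ → φ′ v ∈ˡ L LC v
    coloured-∈L′ {v} v∉R′ with v ∈? U
    ... | yes v∈U = c∈L v∈U
    ... | no v∉U  = coloured-∈L (∉R′⇒∉R v∉R′ v∉U)

    coloured-proper′ : ∀ e {v w} → v ∉ R′ → w ∉ R′ → ¬ Clash e v (φ′ v) w (φ′ w)
    coloured-proper′ e {v} {w} v∉R′ w∉R′ with v ∈? U | w ∈? U
    ... | yes v∈U | yes w∈U = U-clash-free e v∈U w∈U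
    ... | yes v∈U | no w∉U  = reserve-safe (U⊆R v∈U) (c∈A v∈U) e (∉R′⇒∉R w∉R′ w∉U)
    ... | no v∉U  | yes w∈U = λ clash →
      reserve-safe (U⊆R w∈U) (c∈A w∈U) e (∉R′⇒∉R v∉R′ v∉U) (Clash-sym clash)
    ... | no v∉U  | no w∉U  = coloured-proper e (∉R′⇒∉R v∉R′ v∉U) (∉R′⇒∉R w∉R′ w∉U)

    reserve-safe′ : ∀ {v x} → v ∈ R′ → x ∈ˡ A′ v → ∀ e {w} → w ∉ R′ → ¬ Clash e v x w (φ′ w)
    reserve-safe′ {v} v∈R′ x∈ e {w} w∉R′ with w ∈? U
    ... | yes w∈U = λ clash → A′-unblocked x∈ e (w , w∈U , clash)
    ... | no w∉U  = reserve-safe (p─q⊆p R U v∈R′) (A′⊆A x∈) e (∉R′⇒∉R w∉R′ w∉U)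

    admissible′ : Admissible R′ φ′ A′
    admissible′ = record
      { coloured-∈L     = coloured-∈L′
      ; coloured-proper = coloured-proper′
      ; reserve-unique  = λ v∈R′ →
          sieve-unique _ (allFin (m G)) (filter⁺ (∁? (_≟ℕ c)) (reserve-unique (p─q⊆p R U v∈R′)))
      ; reserve-⊆L      = λ v∈R′ x∈ → reserve-⊆L (p─q⊆p R U v∈R′) (A′⊆A x∈)
      ; reserve-safe    = reserve-safe′
      ; reserve-large   = reserve-large′
      }

    shrinks : ∀ {v} → v ∈ R → c ∈ˡ A v → ∣ R′ ∣ < ∣ R ∣
    shrinks {v} v∈R c∈Av = p∩q≢∅⇒∣p─q∣<∣p∣ R U U-meets-R
      where
      U-meets-R : Nonempty (R ∩ U)
      U-meets-R with v ∈? U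
      ... | yes v∈U = v , x∈p∩q⁺ (v∈R , v∈U)
      ... | no v∉U with U-absorbing v (∈⟦⟧⁺ InS? (v∈R , c∈Av)) v∉U
      ...   | u , u∈U , _ = u , x∈p∩q⁺ (U⊆R u∈U , u∈U)

  extend : ∀ {R φ A} → Admissible R φ A → Acc _<_ ∣ R ∣ → Colorable LC
  extend {R} adm (acc smaller) with nonempty? R
  ... | no R-empty = admissible-∅⇒Colorable adm R-empty
  ... | yes (v , v∈R) with ∃-∈-of-suc≤length (Admissible.reserve-large adm v∈R)
  ...   | c , c∈Av = extend (Round.admissible′ adm c) (smaller (Round.shrinks adm c v∈R c∈Av))

theorem3p1 : (G : Multigraph) (LC : CorrAssignment G) →
    IsDerangementAssignment LC →
    (D : Biorientation G) →
    KernelPerfect (StraightArc LC D) →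
    ((e : Fin (m G)) → Twisted LC e → InBoth {G} D e) →
    ((v : Fin (n G)) → suc (outdeg {G} D v) ≤ length (L LC v)) →
    Colorable LC
theorem3p1 G LC derangement D kernel-perfect twisted⇒both large =
  extend (admissible-⊤ large) (<-wellFounded _)
  where open KernelColouring LC derangement D kernel-perfect twisted⇒both
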